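{- Let $n, m, a, b \in \omega$, let $T \in \mathcal{T}(n+m, a, b)$ be a non-empty finite tree, and let $P \subseteq \widehat{T}$ satisfy $m_T P \geq 2^{ -m}$. Then there exists $S \in \mathcal{T}(n,a,b)$ such that $\widehat{S} \subseteq P$ and $m_T(P \setminus \widehat{S}) < 2^{ -m}$.
   Context: Finite subsets of $\omega$ are identified with strictly increasing finite sequences; $[\omega]^{<\omega}$ is the set of such. For $\sigma,\tau\in[\omega]^{<\omega}$, $\sigma\prec\tau$ means $\sigma$ is a proper initial segment of $\tau$ (as sequences), and $\sigma\langle x\rangle$ is the sequence $\sigma$ extended by $x$. A tree is a set $T\subseteq[\omega]^{<\omega}$ closed under initial segments; $\widehat{T}$ is its set of leaves (elements with no proper extension in $T$). For a non-empty finite tree $T$, define $m_T: T\to[0,1]$ by $m_T(\emptyset)=1$, and if $\sigma\in T$ has exactly $k>0$ immediate successors $\sigma\langle x\rangle\in T$, then $m_T(\sigma\langle x\rangle)=k^{ -1}m_T(\sigma)$ for each of them. For a prefix-free $S\subseteq T$, $m_T S=\sum_{\sigma\in S}m_T(\sigma)$ (and $0$ if $S=\emptyset$); for arbitrary $S\subseteq T$, $m_T S=\sup\{m_T R: R\subseteq S \text{ prefix-free}\}$. Let $\epsilon_{n,a,b}(k)=2^{(n+1)(n+k+1)+b+1}(a+k+1)^b$. $\mathcal{T}(n,a,b)$ is the set of finite trees $T\subseteq[\omega]^{<\omega}$ such that every $\sigma\in T\setminus\widehat{T}$ has at least $\epsilon_{n,a,b}(|\sigma|)$ immediate successors $\sigma\langle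 x\rangle \in T$. -}

module Defs where

open import Data.Nat as ℕ using (ℕ; zero; suc; _+_; _*_; _^_; _≤_; _<_; _≡ᵇ_)
open import Data.Bool using (Bool; true; false; _∧_)
open import Data.List using (List; []; _∷_; _++_; _∷ʳ_; length; take; filterᵇ)
open import Data.List.Membership.Propositional using (_∈_)
open import Data.List.Relation.Unary.All using (All)
open import Data.List.Relation.Unary.Unique.Propositional using (Unique)
open import Data.List.Relation.Unary.Linked using (Linked)
open import Data.Product using (Σ; ∃; _×_)
open import Data.Empty using (⊥)
open import Data.Integer using (+_)
open import Relation.Binary.PropositionalEquality using (_≡_)
open import Data.Rational as ℚ using (ℚ; 0ℚ; 1ℚ; ½) renaming (_*_ to _*ℚ_; _+_ to _+ℚ_)

-- Finite sequences of naturals; [ω]^{<ω} = strictly increasing ones.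
Seq : Set
Seq = List ℕ

StrictInc : Seq → Set
StrictInc = Linked _<_

_≺_ : Seq → Seq → Set
σ ≺ τ = Σ ℕ λ x → Σ Seq λ ρ → τ ≡ σ ++ (x ∷ ρ)

-- A finite set of sequences is represented by a duplicate-free list.
FinSet : Set
FinSet = List Seq

record IsFiniteTree (T : FinSet) : Set where
  field
    unique   : Unique T
    strict   : All StrictInc T
    prefixed : ∀ σ i → σ ∈ T → take i σ ∈ T

NonEmpty : FinSet → Set
NonEmpty T = Σ Seq λ σ → σ ∈ T

-- σ is a leaf of T (element of T̂): σ ∈ T with no proper extension in T
Leaf : FinSet → Seq → Set
Leaf T σ = σ ∈ T × (∀ τ → τ ∈ T → σ ≺ τ → ⊥)

eqSeq : Seq → Seq → Bool
eqSeq [] [] = true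
eqSeq [] (_ ∷ _) = false
eqSeq (_ ∷ _) [] = false
eqSeq (x ∷ xs) (y ∷ ys) = (x ≡ᵇ y) ∧ eqSeq xs ys

isChild : Seq → Seq → Bool
isChild σ τ = (length τ ≡ᵇ suc (length σ)) ∧ eqSeq (take (length σ) τ) σ

-- number of immediate successors σ⟨x⟩ ∈ T (T duplicate-free)
childCount : FinSet → Seq → ℕ
childCount T σ = length (filterᵇ (isChild σ) T)

-- 1/k (the value at k = 0 never matters for σ ∈ T)
inv : ℕ → ℚ
inv zero = 0ℚ
inv (suc k) = + 1 ℚ./ suc k

-- m_T(σ) = product over proper prefixes τ of σ of 1/(#children of τ)
mT-go : FinSet → Seq → Seq → ℚ
mT-go T pre [] = 1ℚ
mT-go T pre (x ∷ rest) = inv (childCount T pre) *ℚ mT-go T (pre ∷ʳ x) rest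

mT : FinSet → Seq → ℚ
mT T σ = mT-go T [] σ

-- m_T S for a (duplicate-free, prefix-free) set S: sum of m_T(σ), σ ∈ S
mTset : FinSet → FinSet → ℚ
mTset T [] = 0ℚ
mTset T (σ ∷ S) = mT T σ +ℚ mTset T S

pow½ : ℕ → ℚ
pow½ zero = 1ℚ
pow½ (suc m) = ½ *ℚ pow½ m

ε : ℕ → ℕ → ℕ → ℕ → ℕ
ε n a b k = 2 ^ ((n + 1) * (n + k + 1) + b + 1) * (a + k + 1) ^ b

record InTT (n a b : ℕ) (T : FinSet) : Set where
  field
    isTree    : IsFiniteTree T
    branching : ∀ σ → σ ∈ T → (Leaf T σ → ⊥) → ε n a b (length σ) ≤ childCount T σ

module Submission where

-- For a node σ of T let w(σ) be the m_T-mass of the part of P above σ and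
-- δ(ℓ) = 2^{-m(ℓ+1)}.  Call σ heavy if δ(|σ|)·m_T(σ) ≤ w(σ), and kept if all
-- its initial segments are heavy; S is the set of kept nodes.
--  * S is a tree.  A kept node with K ≥ ε_{n+m}(|σ|) children has at least
--    ε_n(|σ|) kept children: each kept child carries at most its share
--    m_T(σ)/K of P and each other child less than δ(|σ|+1) times it, so the
--    heaviness of σ forces many kept children (enough-kept, resting on the
--    growth of ε in n, ε-step).  Hence S ∈ 𝒯(n,a,b).
--  * A kept node with a child in T therefore has a kept child; a kept node
--    without children is heavy, hence in P.  So the leaves of S lie in P.
--  * By induction from the leaves, the mass of P discarded above a kept node
--    σ is below δ(|σ|+1)·m_T(σ) (discarded-bound).  The root is kept since
--    m_T(P) ≥ 2^{-m}, so the mass of P outside S is below δ(1) ≤ 2^{-m}.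

open import Defs
open import Data.Nat as ℕ using (ℕ; zero; suc; _+_; _*_; _^_)
import Data.Nat.Properties as ℕₚ
import Data.List.Properties as Listₚ
open import Data.Bool using (Bool; true; false; _∧_; not; if_then_else_) renaming (T to IsTrue)
open import Data.Bool.Properties using (T-∧)
open import Relation.Nullary using (¬_; Dec; yes; no)
open import Relation.Nullary.Decidable using (isYes; toWitness; fromWitness) renaming (T? to IsTrue?)
open import Data.List using (List; []; _∷_; _++_; _∷ʳ_; [_]; length; take; drop; map; foldr; filterᵇ)
open import Data.List.Membership.Propositional using (_∈_)
open import Data.List.Relation.Unary.Any using (here; there)
open import Data.List.Relation.Unary.All as All using (All)
open import Data.List.Relation.Unary.AllPairs using ([]; _∷_)
open import Data.List.Relation.Unary.Unique.Propositional using (Unique)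
open import Data.Product using (Σ; _×_; _,_; proj₁; proj₂)
open import Data.Sum using (inj₁; inj₂)
open import Data.Empty using (⊥; ⊥-elim)
open import Function using (_∘_)
open import Function.Bundles using (_⇔_; Equivalence; mk⇔)
open import Relation.Binary.PropositionalEquality hiding ([_])
open import Data.Rational as ℚ using (ℚ; 0ℚ; 1ℚ; ½; _≤_; _<_) renaming (_+_ to _+ℚ_; _*_ to _*ℚ_)
import Data.Rational.Properties as ℚₚ
open import Data.Rational.Solver using (module +-*-Solver)

toℚ : ℕ → ℚ
toℚ zero = 0ℚ
toℚ (suc n) = 1ℚ +ℚ toℚ n

toℚ-+ : ∀ m n → toℚ (m + n) ≡ toℚ m +ℚ toℚ n
toℚ-+ zero n = sym (ℚₚ.+-identityˡ (toℚ n))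
toℚ-+ (suc m) n = trans (cong (1ℚ +ℚ_) (toℚ-+ m n)) (sym (ℚₚ.+-assoc 1ℚ (toℚ m) (toℚ n)))

toℚ-* : ∀ m n → toℚ (m * n) ≡ toℚ m *ℚ toℚ n
toℚ-* zero n = sym (ℚₚ.*-zeroˡ (toℚ n))
toℚ-* (suc m) n = begin
  toℚ (n + m * n)             ≡⟨ toℚ-+ n (m * n) ⟩
  toℚ n +ℚ toℚ (m * n)        ≡⟨ cong (toℚ n +ℚ_) (toℚ-* m n) ⟩
  toℚ n +ℚ toℚ m *ℚ toℚ n     ≡⟨ solve 2 (λ x y → y :+ x :* y := (con 1ℚ :+ x) :* y) refl (toℚ m) (toℚ n) ⟩
  (1ℚ +ℚ toℚ m) *ℚ toℚ n      ∎
  where open ≡-Reasoning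
        open +-*-Solver

toℚ-<-suc : ∀ n → toℚ n < toℚ (suc n)
toℚ-<-suc n = ℚₚ.≤-<-trans (ℚₚ.≤-reflexive (sym (ℚₚ.+-identityˡ (toℚ n))))
  (ℚₚ.+-monoˡ-< (toℚ n) (ℚₚ.positive⁻¹ 1ℚ))

toℚ-nonNeg : ∀ n → 0ℚ ≤ toℚ n
toℚ-nonNeg zero = ℚₚ.≤-refl
toℚ-nonNeg (suc n) = ℚₚ.≤-trans (toℚ-nonNeg n) (ℚₚ.<⇒≤ (toℚ-<-suc n))

toℚ-mono-≤ : ∀ {m n} → m ℕ.≤ n → toℚ m ≤ toℚ n
toℚ-mono-≤ {n = n} ℕ.z≤n = toℚ-nonNeg n
toℚ-mono-≤ (ℕ.s≤s m≤n) = ℚₚ.+-monoʳ-≤ 1ℚ (toℚ-mono-≤ m≤n)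

toℚ-cancel-≤ : ∀ {m n} → toℚ m ≤ toℚ n → m ℕ.≤ n
toℚ-cancel-≤ {m} {n} le with ℕₚ.≤-<-connex m n
... | inj₁ m≤n = m≤n
... | inj₂ n<m = ⊥-elim (ℚₚ.<-irrefl refl (ℚₚ.≤-<-trans le (ℚₚ.<-≤-trans (toℚ-<-suc n) (toℚ-mono-≤ n<m))))

-- 1/K really is the inverse of K: this is what makes the masses of the K
-- children of a node add up to the mass of the node.  The computation is
-- done on unnormalised rationals, where both sides are explicit fractions.
inv-toℚ : ∀ k → inv (suc k) *ℚ toℚ (suc k) ≡ 1ℚ
inv-toℚ k = ℚₚ.toℚᵘ-injective
  (ℚᵘₚ.≃-trans (ℚₚ.toℚᵘ-homo-* (inv (suc k)) (toℚ (suc k)))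
    (ℚᵘₚ.≃-trans (ℚᵘₚ.*-cong (ℚₚ.toℚᵘ-fromℚᵘ (ℚᵘ.mkℚᵘ (+ 1) k)) (toℚᵘ-toℚ (suc k)))
      (ℚᵘ.*≡* (cross k))))
  where
  import Data.Rational.Unnormalised as ℚᵘ
  import Data.Rational.Unnormalised.Properties as ℚᵘₚ
  open import Data.Integer as ℤ using (+_)
  import Data.Integer.Properties as ℤₚ

  toℚᵘ-toℚ : ∀ n → ℚ.toℚᵘ (toℚ n) ℚᵘ.≃ ℚᵘ.mkℚᵘ (+ n) 0
  toℚᵘ-toℚ zero = ℚᵘ.*≡* refl
  toℚᵘ-toℚ (suc n) = ℚᵘₚ.≃-trans (ℚₚ.toℚᵘ-homo-+ 1ℚ (toℚ n))
    (ℚᵘₚ.≃-trans (ℚᵘₚ.+-congʳ (ℚ.toℚᵘ 1ℚ) (toℚᵘ-toℚ n)) (ℚᵘ.*≡* (trans (ℤₚ.*-identityʳ _)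
      (trans (cong (ℤ._+_ (+ 1)) (ℤₚ.*-identityʳ (+ n))) (sym (ℤₚ.*-identityʳ (+ suc n)))))))

  cross : ∀ k → (+ 1 ℤ.* + suc k) ℤ.* + 1 ≡ + 1 ℤ.* + suc (k * 1)
  cross k rewrite ℕₚ.*-identityʳ k = ℤₚ.*-identityʳ _

children-mass : ∀ K M → 0 ℕ.< K → toℚ K *ℚ (M *ℚ inv K) ≡ M
children-mass (suc k) M _ = begin
  toℚ (suc k) *ℚ (M *ℚ inv (suc k))  ≡⟨ solve 3 (λ x y z → x :* (y :* z) := y :* (z :* x)) refl (toℚ (suc k)) M (inv (suc k)) ⟩
  M *ℚ (inv (suc k) *ℚ toℚ (suc k))  ≡⟨ cong (M *ℚ_) (inv-toℚ k) ⟩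
  M *ℚ 1ℚ                           ≡⟨ ℚₚ.*-identityʳ M ⟩
  M                                 ∎
  where open ≡-Reasoning
        open +-*-Solver

inv-pos : ∀ k → 0ℚ < inv (suc k)
inv-pos k = ℚₚ.positive⁻¹ _ {{ℚₚ.normalize-pos 1 (suc k)}}

inv-nonNeg : ∀ k → 0ℚ ≤ inv k
inv-nonNeg zero = ℚₚ.≤-refl
inv-nonNeg (suc k) = ℚₚ.<⇒≤ (inv-pos k)

*-pos : ∀ {p q} → 0ℚ < p → 0ℚ < q → 0ℚ < p *ℚ q
*-pos {p} {q} 0<p 0<q = ℚₚ.positive⁻¹ (p *ℚ q)
  {{ℚₚ.pos*pos⇒pos p {{ℚ.positive 0<p}} q {{ℚ.positive 0<q}}}}

*-nonNeg : ∀ {p q} → 0ℚ ≤ p → 0ℚ ≤ q → 0ℚ ≤ p *ℚ q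
*-nonNeg {p} {q} 0≤p 0≤q = ℚₚ.nonNegative⁻¹ (p *ℚ q)
  {{ℚₚ.nonNeg*nonNeg⇒nonNeg p {{ℚ.nonNegative 0≤p}} q {{ℚ.nonNegative 0≤q}}}}

pow½-halves : ∀ e → pow½ (suc e) +ℚ pow½ (suc e) ≡ pow½ e
pow½-halves e = solve 1 (λ p → con ½ :* p :+ con ½ :* p := p) refl (pow½ e)
  where open +-*-Solver

pow½-pos : ∀ e → 0ℚ < pow½ e
pow½-pos zero = ℚₚ.positive⁻¹ 1ℚ
pow½-pos (suc e) = *-pos (ℚₚ.positive⁻¹ ½) (pow½-pos e)

pow½-antitone : ∀ {e e′} → e ℕ.≤ e′ → pow½ e′ ≤ pow½ e
pow½-antitone {e} {e′} e≤e′ with ℕₚ.m≤n⇒∃[o]m+o≡n e≤e′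
... | d , refl = go e d
  where
  step : ∀ e → pow½ (suc e) ≤ pow½ e
  step e = begin
    pow½ (suc e)                 ≡⟨ ℚₚ.+-identityʳ (pow½ (suc e)) ⟨
    pow½ (suc e) +ℚ 0ℚ           ≤⟨ ℚₚ.+-monoʳ-≤ (pow½ (suc e)) (ℚₚ.<⇒≤ (pow½-pos (suc e))) ⟩
    pow½ (suc e) +ℚ pow½ (suc e)  ≡⟨ pow½-halves e ⟩
    pow½ e                       ∎
    where open ℚₚ.≤-Reasoning
  go : ∀ e d → pow½ (e + d) ≤ pow½ e
  go e zero rewrite ℕₚ.+-identityʳ e = ℚₚ.≤-refl
  go e (suc d) rewrite ℕₚ.+-suc e d = ℚₚ.≤-trans (step (e + d)) (go e d)

pow½-inverse : ∀ e → pow½ e *ℚ toℚ (2 ^ e) ≡ 1ℚ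
pow½-inverse zero = refl
pow½-inverse (suc e) = begin
  ½ *ℚ pow½ e *ℚ toℚ (2 ^ e + (2 ^ e + 0))
    ≡⟨ cong (λ t → ½ *ℚ pow½ e *ℚ t) (trans (toℚ-+ (2 ^ e) _) (cong (toℚ (2 ^ e) +ℚ_) (toℚ-+ (2 ^ e) 0))) ⟩
  ½ *ℚ pow½ e *ℚ (toℚ (2 ^ e) +ℚ (toℚ (2 ^ e) +ℚ 0ℚ))
    ≡⟨ solve 2 (λ p x → con ½ :* p :* (x :+ (x :+ con 0ℚ)) := p :* x) refl (pow½ e) (toℚ (2 ^ e)) ⟩
  pow½ e *ℚ toℚ (2 ^ e)                             ≡⟨ pow½-inverse e ⟩
  1ℚ                                                ∎
  where open ≡-Reasoning
        open +-*-Solver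

pow½-clear : ∀ e K A → pow½ e *ℚ toℚ K ≤ toℚ A → K ℕ.≤ A * 2 ^ e
pow½-clear e K A le = toℚ-cancel-≤ (begin
  toℚ K                                ≡⟨ ℚₚ.*-identityˡ (toℚ K) ⟨
  1ℚ *ℚ toℚ K                          ≡⟨ cong (_*ℚ toℚ K) (pow½-inverse e) ⟨
  pow½ e *ℚ toℚ (2 ^ e) *ℚ toℚ K        ≡⟨ solve 3 (λ h t k → h :* t :* k := h :* k :* t) refl (pow½ e) (toℚ (2 ^ e)) (toℚ K) ⟩
  pow½ e *ℚ toℚ K *ℚ toℚ (2 ^ e)        ≤⟨ ℚₚ.*-monoʳ-≤-nonNeg (toℚ (2 ^ e)) {{ℚ.nonNegative (toℚ-nonNeg (2 ^ e))}} le ⟩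
  toℚ A *ℚ toℚ (2 ^ e)                 ≡⟨ toℚ-* A (2 ^ e) ⟨
  toℚ (A * 2 ^ e)                      ∎)
  where open ℚₚ.≤-Reasoning
        open +-*-Solver

+-cancelʳ-≤ : ∀ x y z → x +ℚ y ≤ z +ℚ y → x ≤ z
+-cancelʳ-≤ x y z le = begin
  x                     ≡⟨ drop-y x ⟨
  (x +ℚ y) +ℚ ℚ.- y     ≤⟨ ℚₚ.+-monoˡ-≤ (ℚ.- y) le ⟩
  (z +ℚ y) +ℚ ℚ.- y     ≡⟨ drop-y z ⟩
  z                     ∎
  where
  open ℚₚ.≤-Reasoning
  drop-y : ∀ w → (w +ℚ y) +ℚ ℚ.- y ≡ w
  drop-y w = trans (ℚₚ.+-assoc w y (ℚ.- y)) (trans (cong (w +ℚ_) (ℚₚ.+-inverseʳ y)) (ℚₚ.+-identityʳ w))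

halving : ∀ {h K A D} → 0ℚ ≤ h → D ≤ K → (h +ℚ h) *ℚ K ≤ A +ℚ D *ℚ h → h *ℚ K ≤ A
halving {h} {K} {A} {D} 0≤h D≤K le = +-cancelʳ-≤ (h *ℚ K) (K *ℚ h) A (begin
  h *ℚ K +ℚ K *ℚ h   ≡⟨ solve 2 (λ h k → h :* k :+ k :* h := (h :+ h) :* k) refl h K ⟩
  (h +ℚ h) *ℚ K      ≤⟨ le ⟩
  A +ℚ D *ℚ h        ≤⟨ ℚₚ.+-monoʳ-≤ A (ℚₚ.*-monoʳ-≤-nonNeg h {{ℚ.nonNegative 0≤h}} D≤K) ⟩
  A +ℚ K *ℚ h        ∎)
  where open ℚₚ.≤-Reasoning
        open +-*-Solver

-- The branching bound ε is positive, and raising n by j+1 multiplies it by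
-- at least 2^{(j+1)(s+1)+1}; this is the slack the pruning consumes.
ε-pos : ∀ n a b s → 0 ℕ.< ε n a b s
ε-pos n a b s = ℕ.>-nonZero⁻¹ (ε n a b s)
  {{ℕₚ.m*n≢0 (2 ^ X) ((a + s + 1) ^ b) {{ℕₚ.m^n≢0 2 X}} {{ℕₚ.m^n≢0 (a + s + 1) b {{ℕ.>-nonZero (ℕₚ.m≤n+m 1 (a + s))}}}}}}
  where
  X : ℕ
  X = (n + 1) * (n + s + 1) + b + 1

ε-step : ∀ n j a b s → 2 ^ suc (suc j * suc s) * ε n a b s ℕ.≤ ε (n + suc j) a b s
ε-step n j a b s = begin
  2 ^ e * (2 ^ X * Y)  ≡⟨ ℕₚ.*-assoc (2 ^ e) (2 ^ X) Y ⟨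
  2 ^ e * 2 ^ X * Y    ≡⟨ cong (_* Y) (ℕₚ.^-distribˡ-+-* 2 e X) ⟨
  2 ^ (e + X) * Y      ≤⟨ ℕₚ.*-monoˡ-≤ Y (ℕₚ.^-monoʳ-≤ 2 exponent) ⟩
  ε (n + suc j) a b s  ∎
  where
  open ℕₚ.≤-Reasoning
  open import Data.Nat.Solver using () renaming (module +-*-Solver to ℕ-Solver)
  open ℕ-Solver
  e X Y : ℕ
  e = suc (suc j * suc s)
  X = (n + 1) * (n + s + 1) + b + 1
  Y = (a + s + 1) ^ b
  exponent : e + X ℕ.≤ (n + suc j + 1) * (n + suc j + s + 1) + b + 1
  exponent = ℕₚ.≤-trans (ℕₚ.m≤m+n (e + X) (j * (2 * n + suc j + 1) + 2 * n + suc j)) (ℕₚ.≤-reflexive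
    (solve 4 (λ n j s b → (con 1 :+ (con 1 :+ j) :* (con 1 :+ s)) :+ ((n :+ con 1) :* (n :+ s :+ con 1) :+ b :+ con 1)
                          :+ (j :* (con 2 :* n :+ (con 1 :+ j) :+ con 1) :+ con 2 :* n :+ (con 1 :+ j))
                       := (n :+ (con 1 :+ j) :+ con 1) :* (n :+ (con 1 :+ j) :+ s :+ con 1) :+ b :+ con 1) refl n j s b))

-- The arithmetic core of the branching estimate.  Consider a node of
-- length s with K = A + D children, A kept and D discarded, and put
-- δ = 2^{-m(s+1)}, δ′ = 2^{-m(s+2)}.
enough-kept : ∀ n m a b s {K A D} → K ≡ A + D →
  pow½ (m * suc s) *ℚ toℚ K ≤ toℚ A +ℚ toℚ D *ℚ pow½ (m * suc (suc s)) →
  (0 ℕ.< D → pow½ (m * suc s) *ℚ toℚ K < toℚ A +ℚ toℚ D *ℚ pow½ (m * suc (suc s))) →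
  ε (n + m) a b s ℕ.≤ K → ε n a b s ℕ.≤ A
enough-kept n zero a b s {K} {A} {zero} refl _ _ εK
  rewrite ℕₚ.+-identityʳ n | ℕₚ.+-identityʳ A = εK
enough-kept n zero a b s {K} {A} {suc D} refl _ balance< _ = ⊥-elim (ℚₚ.<-irrefl refl (begin-strict
  toℚ K                        ≡⟨ ℚₚ.*-identityˡ (toℚ K) ⟨
  1ℚ *ℚ toℚ K                  <⟨ balance< (ℕ.s≤s ℕ.z≤n) ⟩
  toℚ A +ℚ toℚ (suc D) *ℚ 1ℚ   ≡⟨ cong (toℚ A +ℚ_) (ℚₚ.*-identityʳ (toℚ (suc D))) ⟩
  toℚ A +ℚ toℚ (suc D)         ≡⟨ toℚ-+ A (suc D) ⟨
  toℚ K                        ∎))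
  where open ℚₚ.≤-Reasoning
enough-kept n (suc j) a b s {K} {A} {D} K≡A+D balance _ εK =
  ℕₚ.*-cancelˡ-≤ (2 ^ e) {{ℕₚ.m^n≢0 2 e}} (begin
    2 ^ e * ε n a b s      ≤⟨ ε-step n j a b s ⟩
    ε (n + suc j) a b s    ≤⟨ εK ⟩
    K                      ≤⟨ pow½-clear e K A (halving (ℚₚ.<⇒≤ (pow½-pos e)) D≤K halved) ⟩
    A * 2 ^ e              ≡⟨ ℕₚ.*-comm A (2 ^ e) ⟩
    2 ^ e * A              ∎)
  where
  open ℕₚ.≤-Reasoning
  e : ℕ
  e = suc (suc j * suc s)
  D≤K : toℚ D ≤ toℚ K
  D≤K = toℚ-mono-≤ (ℕₚ.≤-trans (ℕₚ.m≤n+m D A) (ℕₚ.≤-reflexive (sym K≡A+D)))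
  δ′≤half : pow½ (suc j * suc (suc s)) ≤ pow½ e
  δ′≤half = pow½-antitone (ℕ.s≤s (ℕₚ.+-monoʳ-≤ (suc s) (ℕₚ.*-monoʳ-≤ j (ℕₚ.n≤1+n (suc s)))))
  halved : (pow½ e +ℚ pow½ e) *ℚ toℚ K ≤ toℚ A +ℚ toℚ D *ℚ pow½ e
  halved = ℚₚ.≤-trans (ℚₚ.≤-reflexive (cong (_*ℚ toℚ K) (pow½-halves (suc j * suc s))))
    (ℚₚ.≤-trans balance (ℚₚ.+-monoʳ-≤ (toℚ A) (ℚₚ.*-monoˡ-≤-nonNeg (toℚ D) {{ℚ.nonNegative (toℚ-nonNeg D)}} δ′≤half)))

private
  variable
    A B : Set

not-both : ∀ {b} → IsTrue b → ¬ IsTrue (not b)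
not-both {true} _ ()

not-either : ∀ {b} → ¬ IsTrue b → IsTrue (not b)
not-either {true} b-false = b-false _
not-either {false} _ = _

sumOver : (A → ℚ) → List A → ℚ
sumOver f xs = foldr _+ℚ_ 0ℚ (map f xs)

restrict : (A → Bool) → (A → ℚ) → A → ℚ
restrict q f x = if q x then f x else 0ℚ

restrict-true : ∀ (q : A → Bool) (f : A → ℚ) {x} → IsTrue (q x) → restrict q f x ≡ f x
restrict-true q f {x} t with q x
... | true = refl

restrict-false : ∀ (q : A → Bool) (f : A → ℚ) {x} → ¬ IsTrue (q x) → restrict q f x ≡ 0ℚ
restrict-false q f {x} nt with q x
... | true = ⊥-elim (nt _)
... | false = refl

sumOver-cong : ∀ {f g : A → ℚ} xs → (∀ x → x ∈ xs → f x ≡ g x) → sumOver f xs ≡ sumOver g xs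
sumOver-cong [] eq = refl
sumOver-cong (x ∷ xs) eq = cong₂ _+ℚ_ (eq x (here refl)) (sumOver-cong xs (λ y y∈ → eq y (there y∈)))

sumOver-zero : ∀ {f : A → ℚ} xs → (∀ x → x ∈ xs → f x ≡ 0ℚ) → sumOver f xs ≡ 0ℚ
sumOver-zero [] eq = refl
sumOver-zero (x ∷ xs) eq rewrite eq x (here refl) | sumOver-zero xs (λ y y∈ → eq y (there y∈)) = refl

sumOver-+ : ∀ (f g : A → ℚ) xs → sumOver (λ x → f x +ℚ g x) xs ≡ sumOver f xs +ℚ sumOver g xs
sumOver-+ f g [] = refl
sumOver-+ f g (x ∷ xs) rewrite sumOver-+ f g xs =
  solve 4 (λ a b c d → (a :+ b) :+ (c :+ d) := (a :+ c) :+ (b :+ d)) refl (f x) (g x) (sumOver f xs) (sumOver g xs)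
  where open +-*-Solver

sumOver-swap : ∀ (F : B → A → ℚ) (ys : List B) xs →
  sumOver (λ x → sumOver (λ y → F y x) ys) xs ≡ sumOver (λ y → sumOver (F y) xs) ys
sumOver-swap F ys [] = sym (sumOver-zero ys (λ _ _ → refl))
sumOver-swap F ys (x ∷ xs) rewrite sumOver-swap F ys xs = sym (sumOver-+ (λ y → F y x) (λ y → sumOver (F y) xs) ys)

sumOver-mono : ∀ {f g : A → ℚ} xs → (∀ x → x ∈ xs → f x ≤ g x) → sumOver f xs ≤ sumOver g xs
sumOver-mono [] le = ℚₚ.≤-refl
sumOver-mono (x ∷ xs) le = ℚₚ.+-mono-≤ (le x (here refl)) (sumOver-mono xs (λ y y∈ → le y (there y∈)))

sumOver-bound : ∀ {f : A → ℚ} {B} xs → (∀ x → x ∈ xs → f x ≤ B) → sumOver f xs ≤ toℚ (length xs) *ℚ B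
sumOver-bound {B = B} [] le = ℚₚ.≤-reflexive (sym (ℚₚ.*-zeroˡ B))
sumOver-bound {B = B} (x ∷ xs) le = ℚₚ.≤-trans
  (ℚₚ.+-mono-≤ (le x (here refl)) (sumOver-bound xs (λ y y∈ → le y (there y∈))))
  (ℚₚ.≤-reflexive (add-one B (length xs)))
  where
  add-one : ∀ B n → B +ℚ toℚ n *ℚ B ≡ toℚ (suc n) *ℚ B
  add-one B n = solve 2 (λ b k → b :+ k :* b := (con 1ℚ :+ k) :* b) refl B (toℚ n)
    where open +-*-Solver

sumOver-bound-< : ∀ {f : A → ℚ} {B} xs → (∀ x → x ∈ xs → f x < B) → 0 ℕ.< length xs →
  sumOver f xs < toℚ (length xs) *ℚ B
sumOver-bound-< {B = B} (x ∷ xs) lt _ = ℚₚ.<-≤-trans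
  (ℚₚ.+-mono-<-≤ (lt x (here refl)) (sumOver-bound xs (λ y y∈ → ℚₚ.<⇒≤ (lt y (there y∈)))))
  (ℚₚ.≤-reflexive (solve 2 (λ b k → b :+ k :* b := (con 1ℚ :+ k) :* b) refl B (toℚ (length xs))))
  where open +-*-Solver

sumOver-restrict : ∀ (q : A → Bool) (f : A → ℚ) xs → sumOver (restrict q f) xs ≡ sumOver f (filterᵇ q xs)
sumOver-restrict q f [] = refl
sumOver-restrict q f (x ∷ xs) with q x
... | true = cong (f x +ℚ_) (sumOver-restrict q f xs)
... | false = trans (ℚₚ.+-identityˡ _) (sumOver-restrict q f xs)

sumOver-split : ∀ (q : A → Bool) (f : A → ℚ) xs →
  sumOver f xs ≡ sumOver f (filterᵇ q xs) +ℚ sumOver f (filterᵇ (not ∘ q) xs)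
sumOver-split q f [] = sym (ℚₚ.+-identityˡ 0ℚ)
sumOver-split q f (x ∷ xs) with q x
... | true = trans (cong (f x +ℚ_) (sumOver-split q f xs)) (sym (ℚₚ.+-assoc (f x) _ _))
... | false = trans (cong (f x +ℚ_) (sumOver-split q f xs))
    (solve 3 (λ a b c → a :+ (b :+ c) := b :+ (a :+ c)) refl (f x)
      (sumOver f (filterᵇ q xs)) (sumOver f (filterᵇ (not ∘ q) xs)))
  where open +-*-Solver

length-split : ∀ (q : A → Bool) xs → length xs ≡ length (filterᵇ q xs) + length (filterᵇ (not ∘ q) xs)
length-split q [] = refl
length-split q (x ∷ xs) with q x
... | true = cong suc (length-split q xs)
... | false = trans (cong suc (length-split q xs)) (sym (ℕₚ.+-suc _ _))

member-of-nonempty : ∀ (xs : List A) → 0 ℕ.< length xs → Σ A (_∈ xs)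
member-of-nonempty (x ∷ _) _ = x , here refl

∈-filterᵇ⁻ : ∀ (q : A → Bool) {x xs} → x ∈ filterᵇ q xs → x ∈ xs × IsTrue (q x)
∈-filterᵇ⁻ q = ∈-filter⁻ (IsTrue? ∘ q)
  where open import Data.List.Membership.Propositional.Properties using (∈-filter⁻)

∈-filterᵇ⁺ : ∀ (q : A → Bool) {x xs} → x ∈ xs → IsTrue (q x) → x ∈ filterᵇ q xs
∈-filterᵇ⁺ q = ∈-filter⁺ (IsTrue? ∘ q)
  where open import Data.List.Membership.Propositional.Properties using (∈-filter⁺)

unique-filterᵇ : ∀ (q : A → Bool) {xs} → Unique xs → Unique (filterᵇ q xs)
unique-filterᵇ q = filter⁺ (IsTrue? ∘ q)
  where open import Data.List.Relation.Unary.Unique.Propositional.Properties using (filter⁺)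

filterᵇ-accept : ∀ (r : A → Bool) {x xs} → IsTrue (r x) → filterᵇ r (x ∷ xs) ≡ x ∷ filterᵇ r xs
filterᵇ-accept r = Listₚ.filter-accept (IsTrue? ∘ r)

filterᵇ-reject : ∀ (r : A → Bool) {x xs} → ¬ IsTrue (r x) → filterᵇ r (x ∷ xs) ≡ filterᵇ r xs
filterᵇ-reject r = Listₚ.filter-reject (IsTrue? ∘ r)

filterᵇ-comm : ∀ (p q : A → Bool) xs → filterᵇ p (filterᵇ q xs) ≡ filterᵇ q (filterᵇ p xs)
filterᵇ-comm p q [] = refl
filterᵇ-comm p q (x ∷ xs) = by-cases (IsTrue? (p x)) (IsTrue? (q x))
  where
  ih : filterᵇ p (filterᵇ q xs) ≡ filterᵇ q (filterᵇ p xs)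
  ih = filterᵇ-comm p q xs
  via : ∀ {ys zs} → filterᵇ q (x ∷ xs) ≡ ys → filterᵇ p (x ∷ xs) ≡ zs → filterᵇ p ys ≡ filterᵇ q zs →
    filterᵇ p (filterᵇ q (x ∷ xs)) ≡ filterᵇ q (filterᵇ p (x ∷ xs))
  via e₁ e₂ e₃ = trans (cong (filterᵇ p) e₁) (trans e₃ (sym (cong (filterᵇ q) e₂)))
  by-cases : Dec (IsTrue (p x)) → Dec (IsTrue (q x)) →
    filterᵇ p (filterᵇ q (x ∷ xs)) ≡ filterᵇ q (filterᵇ p (x ∷ xs))
  by-cases (yes px) (yes qx) = via (filterᵇ-accept q qx) (filterᵇ-accept p px)
    (trans (filterᵇ-accept p px) (trans (cong (x ∷_) ih) (sym (filterᵇ-accept q qx))))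
  by-cases (yes px) (no ¬qx) = via (filterᵇ-reject q ¬qx) (filterᵇ-accept p px) (trans ih (sym (filterᵇ-reject q ¬qx)))
  by-cases (no ¬px) (yes qx) = via (filterᵇ-accept q qx) (filterᵇ-reject p ¬px) (trans (filterᵇ-reject p ¬px) ih)
  by-cases (no ¬px) (no ¬qx) = via (filterᵇ-reject q ¬qx) (filterᵇ-reject p ¬px) ih

sumOver-single : ∀ (q : A → Bool) (f : A → ℚ) {x₀} xs → Unique xs → x₀ ∈ xs → IsTrue (q x₀) →
  (∀ x → x ∈ xs → IsTrue (q x) → x ≡ x₀) → sumOver (restrict q f) xs ≡ f x₀
sumOver-single q f (x ∷ xs) (x∉ ∷ u) (here refl) qx only = begin
  restrict q f x +ℚ sumOver (restrict q f) xs  ≡⟨ cong₂ _+ℚ_ (restrict-true q f qx) (sumOver-zero xs off) ⟩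
  f x +ℚ 0ℚ                                    ≡⟨ ℚₚ.+-identityʳ (f x) ⟩
  f x                                          ∎
  where
  open ≡-Reasoning
  off : ∀ y → y ∈ xs → restrict q f y ≡ 0ℚ
  off y y∈ = restrict-false q f λ qy → All.lookup x∉ y∈ (sym (only y (there y∈) qy))
sumOver-single q f {x₀} (x ∷ xs) (x∉ ∷ u) (there x₀∈) qx₀ only = begin
  restrict q f x +ℚ sumOver (restrict q f) xs  ≡⟨ cong₂ _+ℚ_ (restrict-false q f (λ qx → All.lookup x∉ x₀∈ (only x (here refl) qx)))
                                                    (sumOver-single q f xs u x₀∈ qx₀ (λ y y∈ → only y (there y∈))) ⟩
  0ℚ +ℚ f x₀                                   ≡⟨ ℚₚ.+-identityˡ (f x₀) ⟩
  f x₀                                         ∎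
  where open ≡-Reasoning

sumOver-≤-single : ∀ (q : A → Bool) (f : A → ℚ) {x₀} xs → Unique xs → 0ℚ ≤ f x₀ →
  (∀ x → IsTrue (q x) → x ≡ x₀) → sumOver (restrict q f) xs ≤ f x₀
sumOver-≤-single q f [] [] 0≤f only = 0≤f
sumOver-≤-single q f (x ∷ xs) (x∉ ∷ u) 0≤f only with IsTrue? (q x)
... | yes qx with only x qx
...   | refl = ℚₚ.≤-reflexive (sumOver-single q f (x ∷ xs) (x∉ ∷ u) (here refl) qx (λ y _ qy → only y qy))
sumOver-≤-single q f (x ∷ xs) (x∉ ∷ u) 0≤f only | no ¬qx = begin
  restrict q f x +ℚ sumOver (restrict q f) xs  ≡⟨ cong (_+ℚ sumOver (restrict q f) xs) (restrict-false q f ¬qx) ⟩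
  0ℚ +ℚ sumOver (restrict q f) xs              ≡⟨ ℚₚ.+-identityˡ _ ⟩
  sumOver (restrict q f) xs                    ≤⟨ sumOver-≤-single q f xs u 0≤f only ⟩
  f _                                          ∎
  where open ℚₚ.≤-Reasoning

sumOver-pos : ∀ (q : A → Bool) (f : A → ℚ) xs → 0ℚ < sumOver (restrict q f) xs → Σ A λ x → x ∈ xs × IsTrue (q x)
sumOver-pos q f [] 0<0 = ⊥-elim (ℚₚ.<-irrefl refl 0<0)
sumOver-pos q f (x ∷ xs) 0<sum with IsTrue? (q x)
... | yes qx = x , here refl , qx
... | no ¬qx with sumOver-pos q f xs (ℚₚ.<-≤-trans 0<sum (ℚₚ.≤-reflexive
                   (trans (cong (_+ℚ _) (restrict-false q f ¬qx)) (ℚₚ.+-identityˡ _))))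
...   | y , y∈ , qy = y , there y∈ , qy

sumOver-sameSet : ∀ (f : A → ℚ) {xs ys} → Unique xs → Unique ys → (∀ {x} → x ∈ xs ⇔ x ∈ ys) →
  sumOver f xs ≡ sumOver f ys
sumOver-sameSet f ux uy same =
  foldr-commMonoid ℚₚ.+-0-isCommutativeMonoid (↭⇒↭ₛ (↭-map⁺ f (∼bag⇒↭ (unique∧set⇒bag ux uy same))))
  where
  open import Data.List.Membership.Propositional.Properties.WithK using (unique∧set⇒bag)
  open import Data.List.Relation.Binary.BagAndSetEquality using (∼bag⇒↭)
  open import Data.List.Relation.Binary.Permutation.Propositional using (↭⇒↭ₛ)
  open import Data.List.Relation.Binary.Permutation.Propositional.Properties using () renaming (map⁺ to ↭-map⁺)
  open import Data.List.Relation.Binary.Permutation.Setoid.Properties (setoid ℚ) using (foldr-commMonoid)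

eqSeq-sound : ∀ σ τ → IsTrue (eqSeq σ τ) → σ ≡ τ
eqSeq-sound [] [] _ = refl
eqSeq-sound (x ∷ σ) (y ∷ τ) t with Equivalence.to (T-∧ {x ℕ.≡ᵇ y}) t
... | x≡y , σ≡τ = cong₂ _∷_ (ℕₚ.≡ᵇ⇒≡ x y x≡y) (eqSeq-sound σ τ σ≡τ)

eqSeq-refl : ∀ σ → IsTrue (eqSeq σ σ)
eqSeq-refl [] = _
eqSeq-refl (x ∷ σ) = Equivalence.from (T-∧ {x ℕ.≡ᵇ x}) (ℕₚ.≡⇒≡ᵇ x x refl , eqSeq-refl σ)

_⊑ᵇ_ : Seq → Seq → Bool
[] ⊑ᵇ τ = true
(x ∷ σ) ⊑ᵇ [] = false
(x ∷ σ) ⊑ᵇ (y ∷ τ) = (x ℕ.≡ᵇ y) ∧ (σ ⊑ᵇ τ)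

⊑ᵇ-sound : ∀ σ τ → IsTrue (σ ⊑ᵇ τ) → Σ Seq λ ρ → τ ≡ σ ++ ρ
⊑ᵇ-sound [] τ _ = τ , refl
⊑ᵇ-sound (x ∷ σ) (y ∷ τ) t with Equivalence.to (T-∧ {x ℕ.≡ᵇ y}) t
... | x≡y , σ⊑τ with ⊑ᵇ-sound σ τ σ⊑τ | ℕₚ.≡ᵇ⇒≡ x y x≡y
... | ρ , refl | refl = ρ , refl

⊑ᵇ-complete : ∀ σ ρ → IsTrue (σ ⊑ᵇ (σ ++ ρ))
⊑ᵇ-complete [] ρ = _
⊑ᵇ-complete (x ∷ σ) ρ = Equivalence.from (T-∧ {x ℕ.≡ᵇ x}) (ℕₚ.≡⇒≡ᵇ x x refl , ⊑ᵇ-complete σ ρ)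

length-∷ʳ : ∀ (σ : Seq) x → length (σ ∷ʳ x) ≡ suc (length σ)
length-∷ʳ σ x = trans (Listₚ.length-++ σ) (ℕₚ.+-comm (length σ) 1)

take-++ : ∀ (σ ρ : Seq) → take (length σ) (σ ++ ρ) ≡ σ
take-++ [] ρ = refl
take-++ (x ∷ σ) ρ = cong (x ∷_) (take-++ σ ρ)

isChild-complete : ∀ σ x → IsTrue (isChild σ (σ ∷ʳ x))
isChild-complete σ x = Equivalence.from (T-∧ {length (σ ∷ʳ x) ℕ.≡ᵇ suc (length σ)})
  (ℕₚ.≡⇒≡ᵇ _ _ (length-∷ʳ σ x) , subst (λ τ → IsTrue (eqSeq τ σ)) (sym (take-++ σ [ x ])) (eqSeq-refl σ))

length≡1 : ∀ (ρ : List A) → length ρ ≡ 1 → Σ A λ x → ρ ≡ [ x ]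
length≡1 (x ∷ []) _ = x , refl

length-drop-one : ∀ (σ τ : Seq) → length τ ≡ suc (length σ) → length (drop (length σ) τ) ≡ 1
length-drop-one σ τ len = begin
  length (drop (length σ) τ)   ≡⟨ Listₚ.length-drop (length σ) τ ⟩
  length τ ℕ.∸ length σ        ≡⟨ cong (ℕ._∸ length σ) len ⟩
  suc (length σ) ℕ.∸ length σ  ≡⟨ ℕₚ.m+n∸n≡m 1 (length σ) ⟩
  1                            ∎
  where open ≡-Reasoning

isChild-sound : ∀ σ τ → IsTrue (isChild σ τ) → Σ ℕ λ x → τ ≡ σ ∷ʳ x
isChild-sound σ τ t with Equivalence.to (T-∧ {length τ ℕ.≡ᵇ suc (length σ)}) t
... | len , pre with length≡1 (drop (length σ) τ) (length-drop-one σ τ (ℕₚ.≡ᵇ⇒≡ _ _ len))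
... | x , rest = x , (begin
  τ                                       ≡⟨ Listₚ.take++drop≡id (length σ) τ ⟨
  take (length σ) τ ++ drop (length σ) τ  ≡⟨ cong₂ _++_ (eqSeq-sound _ _ pre) rest ⟩
  σ ∷ʳ x                                  ∎)
  where open ≡-Reasoning

mass-child : ∀ T σ x → mT T (σ ∷ʳ x) ≡ mT T σ *ℚ inv (childCount T σ)
mass-child T σ x = go [] σ
  where
  go : ∀ pre σ → mT-go T pre (σ ∷ʳ x) ≡ mT-go T pre σ *ℚ inv (childCount T (pre ++ σ))
  go pre [] rewrite Listₚ.++-identityʳ pre = ℚₚ.*-comm (inv (childCount T pre)) 1ℚ
  go pre (y ∷ σ) rewrite go (pre ∷ʳ y) σ | Listₚ.++-assoc pre [ y ] σ =
    sym (ℚₚ.*-assoc (inv (childCount T pre)) _ _)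

mass-nonNeg : ∀ T σ → 0ℚ ≤ mT T σ
mass-nonNeg T σ = go [] σ
  where
  go : ∀ pre σ → 0ℚ ≤ mT-go T pre σ
  go pre [] = ℚₚ.<⇒≤ (ℚₚ.positive⁻¹ 1ℚ)
  go pre (x ∷ σ) = *-nonNeg (inv-nonNeg (childCount T pre)) (go (pre ∷ʳ x) σ)

mTset≡sumOver : ∀ T L → mTset T L ≡ sumOver (mT T) L
mTset≡sumOver T [] = refl
mTset≡sumOver T (σ ∷ L) = cong (mT T σ +ℚ_) (mTset≡sumOver T L)

coneSum : (Seq → ℚ) → FinSet → Seq → ℚ
coneSum h L σ = sumOver (restrict (σ ⊑ᵇ_) h) L

module FiniteTree {T : FinSet} (tree : IsFiniteTree T) where
  open IsFiniteTree tree

  children : Seq → FinSet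
  children σ = filterᵇ (isChild σ) T

  children-unique : ∀ σ → Unique (children σ)
  children-unique σ = unique-filterᵇ (isChild σ) unique

  child-shape : ∀ σ {c} → c ∈ children σ → c ∈ T × Σ ℕ λ x → c ≡ σ ∷ʳ x
  child-shape σ {c} c∈ with ∈-filterᵇ⁻ (isChild σ) c∈
  ... | c∈T , t = c∈T , isChild-sound σ c t

  extension-child : ∀ {σ τ x ρ} → τ ∈ T → τ ≡ σ ++ x ∷ ρ → σ ∷ʳ x ∈ children σ
  extension-child {σ} {τ} {x} {ρ} τ∈T refl = ∈-filterᵇ⁺ (isChild σ)
    (subst (_∈ T) (take-step σ) (prefixed τ (suc (length σ)) τ∈T)) (isChild-complete σ x)
    where
    take-step : ∀ (σ : Seq) → take (suc (length σ)) (σ ++ x ∷ ρ) ≡ σ ∷ʳ x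
    take-step [] = refl
    take-step (y ∷ σ) = cong (y ∷_) (take-step σ)

  child⇒¬leaf : ∀ σ {c} → c ∈ children σ → ¬ Leaf T σ
  child⇒¬leaf σ c∈ (_ , no-ext) with child-shape σ c∈
  ... | c∈T , x , refl = no-ext (σ ∷ʳ x) c∈T (x , [] , refl)

  child-mass : ∀ σ {c} → c ∈ children σ → mT T c ≡ mT T σ *ℚ inv (childCount T σ)
  child-mass σ c∈ with child-shape σ c∈
  ... | _ , x , refl = mass-child T σ x

  child-length : ∀ σ {c} → c ∈ children σ → length c ≡ suc (length σ)
  child-length σ c∈ with child-shape σ c∈
  ... | _ , x , refl = length-∷ʳ σ x

  nonempty : ∀ σ {c} → c ∈ children σ → 0 ℕ.< childCount T σ
  nonempty σ c∈ with children σ | c∈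
  ... | _ ∷ _ | _ = ℕ.s≤s ℕ.z≤n

  share-out : ∀ σ {c} d → c ∈ children σ →
    toℚ (childCount T σ) *ℚ (d *ℚ (mT T σ *ℚ inv (childCount T σ))) ≡ d *ℚ mT T σ
  share-out σ d c∈ = begin
    toℚ K *ℚ (d *ℚ (mT T σ *ℚ inv K))
      ≡⟨ solve 4 (λ k d m i → k :* (d :* (m :* i)) := d :* (k :* (m :* i))) refl (toℚ K) d (mT T σ) (inv K) ⟩
    d *ℚ (toℚ K *ℚ (mT T σ *ℚ inv K))  ≡⟨ cong (d *ℚ_) (children-mass K (mT T σ) (nonempty σ c∈)) ⟩
    d *ℚ mT T σ                        ∎
    where
    open ≡-Reasoning
    open +-*-Solver
    K : ℕ
    K = childCount T σ

  -- Nodes of T have positive mass: along the path to σ every node has a child.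
  mass-pos : ∀ {σ} → σ ∈ T → 0ℚ < mT T σ
  mass-pos {σ} = go [] σ
    where
    inv-count-pos : ∀ σ {c} → c ∈ children σ → 0ℚ < inv (childCount T σ)
    inv-count-pos σ c∈ with childCount T σ | nonempty σ c∈
    ... | suc k | _ = inv-pos k
    go : ∀ pre σ → (pre ++ σ) ∈ T → 0ℚ < mT-go T pre σ
    go pre [] _ = ℚₚ.positive⁻¹ 1ℚ
    go pre (x ∷ σ) ∈T = *-pos (inv-count-pos pre (extension-child {pre} ∈T refl))
      (go (pre ∷ʳ x) σ (subst (_∈ T) (sym (Listₚ.++-assoc pre [ x ] σ)) ∈T))

  -- Induction from the leaves up: children are longer than their parent,
  -- and lengths in T are bounded.
  tree-ind : (Φ : Seq → Set) → (∀ σ → (∀ c → c ∈ children σ → Φ c) → Φ σ) → ∀ σ → Φ σ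
  tree-ind Φ step σ = go height σ (ℕₚ.m≤m+n height (length σ))
    where
    height : ℕ
    height = foldr ℕ._⊔_ 0 (map length T)
    length≤height : ∀ {τ} L → τ ∈ L → length τ ℕ.≤ foldr ℕ._⊔_ 0 (map length L)
    length≤height (τ ∷ L) (here refl) = ℕₚ.m≤m⊔n (length τ) _
    length≤height (υ ∷ L) (there τ∈) = ℕₚ.≤-trans (length≤height L τ∈) (ℕₚ.m≤n⊔m (length υ) _)
    go : ∀ h σ → height ℕ.≤ h + length σ → Φ σ
    go zero σ bound = step σ λ c c∈ → ⊥-elim (too-long c c∈)
      where
      too-long : ∀ c → c ∈ children σ → ⊥
      too-long c c∈ with child-shape σ c∈
      ... | c∈T , x , refl = ℕₚ.<-irrefl refl (ℕₚ.≤-trans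
        (ℕₚ.≤-trans (ℕₚ.≤-reflexive (sym (length-∷ʳ σ x))) (length≤height T c∈T)) bound)
    go (suc h) σ bound = step σ λ c c∈ → below c c∈
      where
      below : ∀ c → c ∈ children σ → Φ c
      below c c∈ with child-shape σ c∈
      ... | _ , x , refl = go h (σ ∷ʳ x) (ℕₚ.≤-trans bound
        (ℕₚ.≤-reflexive (trans (sym (ℕₚ.+-suc h (length σ))) (cong (h +_) (sym (length-∷ʳ σ x))))))

  child-prefix : ∀ σ {c τ} → c ∈ children σ → IsTrue (c ⊑ᵇ τ) →
    Σ ℕ λ x → Σ Seq λ ρ → τ ≡ σ ++ x ∷ ρ × c ≡ σ ∷ʳ x
  child-prefix σ {c} {τ} c∈ c⊑τ with child-shape σ c∈ | ⊑ᵇ-sound c τ c⊑τ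
  ... | _ , x , refl | ρ , refl = x , ρ , Listₚ.++-assoc σ [ x ] ρ , refl

  childwise : Seq → (Seq → ℚ) → Seq → ℚ
  childwise σ h τ = restrict (eqSeq σ) h τ +ℚ sumOver (λ c → restrict (c ⊑ᵇ_) h τ) (children σ)

  childwise-outside : ∀ σ h {τ} → ¬ IsTrue (σ ⊑ᵇ τ) → childwise σ h τ ≡ 0ℚ
  childwise-outside σ h {τ} σ⋢τ = begin
    childwise σ h τ  ≡⟨ cong₂ _+ℚ_ (restrict-false (eqSeq σ) h (σ⋢τ ∘ equal⇒⊑))
                         (sumOver-zero (children σ) (λ c c∈ → restrict-false (c ⊑ᵇ_) h (σ⋢τ ∘ child⇒⊑ c∈))) ⟩
    0ℚ +ℚ 0ℚ         ≡⟨ ℚₚ.+-identityˡ 0ℚ ⟩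
    0ℚ               ∎
    where
    open ≡-Reasoning
    equal⇒⊑ : IsTrue (eqSeq σ τ) → IsTrue (σ ⊑ᵇ τ)
    equal⇒⊑ t with eqSeq-sound σ τ t
    ... | refl = subst (IsTrue ∘ (σ ⊑ᵇ_)) (Listₚ.++-identityʳ σ) (⊑ᵇ-complete σ [])
    child⇒⊑ : ∀ {c} → c ∈ children σ → IsTrue (c ⊑ᵇ τ) → IsTrue (σ ⊑ᵇ τ)
    child⇒⊑ c∈ c⊑τ with child-prefix σ c∈ c⊑τ
    ... | x , ρ , refl , _ = ⊑ᵇ-complete σ (x ∷ ρ)

  childwise-self : ∀ σ h {τ} → τ ≡ σ → childwise σ h τ ≡ h τ
  childwise-self σ h {τ} refl = begin
    childwise σ h σ  ≡⟨ cong₂ _+ℚ_ (restrict-true (eqSeq σ) h (eqSeq-refl σ))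
                         (sumOver-zero (children σ) (λ c c∈ → restrict-false (c ⊑ᵇ_) h (no-child c∈))) ⟩
    h σ +ℚ 0ℚ        ≡⟨ ℚₚ.+-identityʳ (h σ) ⟩
    h σ              ∎
    where
    open ≡-Reasoning
    no-child : ∀ {c} → c ∈ children σ → ¬ IsTrue (c ⊑ᵇ σ)
    no-child c∈ c⊑σ with child-prefix σ c∈ c⊑σ
    ... | x , ρ , eq , _ with Listₚ.++-cancelˡ σ [] (x ∷ ρ) (trans (Listₚ.++-identityʳ σ) eq)
    ... | ()

  childwise-below : ∀ σ h {x ρ} → σ ++ x ∷ ρ ∈ T → childwise σ h (σ ++ x ∷ ρ) ≡ h (σ ++ x ∷ ρ)
  childwise-below σ h {x} {ρ} τ∈T = begin
    childwise σ h τ  ≡⟨ cong₂ _+ℚ_ (restrict-false (eqSeq σ) h not-self)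
                         (sumOver-single (_⊑ᵇ τ) (λ _ → h τ) (children σ) (children-unique σ)
                           (extension-child τ∈T refl) σx⊑τ only-σx) ⟩
    0ℚ +ℚ h τ        ≡⟨ ℚₚ.+-identityˡ (h τ) ⟩
    h τ              ∎
    where
    open ≡-Reasoning
    τ : Seq
    τ = σ ++ x ∷ ρ
    not-self : ¬ IsTrue (eqSeq σ τ)
    not-self t with Listₚ.++-cancelˡ σ [] (x ∷ ρ) (trans (Listₚ.++-identityʳ σ) (eqSeq-sound _ _ t))
    ... | ()
    σx⊑τ : IsTrue ((σ ∷ʳ x) ⊑ᵇ τ)
    σx⊑τ = subst (IsTrue ∘ ((σ ∷ʳ x) ⊑ᵇ_)) (Listₚ.++-assoc σ [ x ] ρ) (⊑ᵇ-complete (σ ∷ʳ x) ρ)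
    only-σx : ∀ c → c ∈ children σ → IsTrue (c ⊑ᵇ τ) → c ≡ σ ∷ʳ x
    only-σx c c∈ c⊑τ with child-prefix σ c∈ c⊑τ
    ... | y , ρ′ , eq , refl with Listₚ.++-cancelˡ σ (x ∷ ρ) (y ∷ ρ′) eq
    ... | refl = refl

  -- Pointwise cone decomposition: for τ ∈ T, σ ⊑ τ holds iff either τ = σ
  -- or c ⊑ τ for exactly one child c of σ.
  cone-pointwise : ∀ σ h {τ} → τ ∈ T → restrict (σ ⊑ᵇ_) h τ ≡ childwise σ h τ
  cone-pointwise σ h {τ} τ∈T with IsTrue? (σ ⊑ᵇ τ)
  ... | no σ⋢τ = trans (restrict-false (σ ⊑ᵇ_) h σ⋢τ) (sym (childwise-outside σ h σ⋢τ))
  ... | yes σ⊑τ with ⊑ᵇ-sound σ τ σ⊑τ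
  ...   | [] , refl = trans (restrict-true (σ ⊑ᵇ_) h σ⊑τ) (sym (childwise-self σ h (Listₚ.++-identityʳ σ)))
  ...   | x ∷ ρ , refl = trans (restrict-true (σ ⊑ᵇ_) h σ⊑τ) (sym (childwise-below σ h τ∈T))

  cone-decomposition : ∀ σ h L → All (_∈ T) L →
    coneSum h L σ ≡ sumOver (restrict (eqSeq σ) h) L +ℚ sumOver (coneSum h L) (children σ)
  cone-decomposition σ h L L⊆T = begin
    sumOver (restrict (σ ⊑ᵇ_) h) L
      ≡⟨ sumOver-cong L (λ τ τ∈ → cone-pointwise σ h (All.lookup L⊆T τ∈)) ⟩
    sumOver (childwise σ h) L
      ≡⟨ sumOver-+ (restrict (eqSeq σ) h) _ L ⟩
    sumOver (restrict (eqSeq σ) h) L +ℚ sumOver (λ τ → sumOver (λ c → restrict (c ⊑ᵇ_) h τ) (children σ)) L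
      ≡⟨ cong (sumOver (restrict (eqSeq σ) h) L +ℚ_) (sumOver-swap (λ c → restrict (c ⊑ᵇ_) h) (children σ) L) ⟩
    sumOver (restrict (eqSeq σ) h) L +ℚ sumOver (coneSum h L) (children σ) ∎
    where open ≡-Reasoning

  data ChildView (σ : Seq) : Set where
    childless : children σ ≡ [] → ChildView σ
    has-child : ∀ {c} → c ∈ children σ → ChildView σ

  child-view : ∀ σ → ChildView σ
  child-view σ with children σ in eq
  ... | [] = childless eq
  ... | c ∷ _ = has-child (subst (c ∈_) (sym eq) (here refl))

  -- Cone sums over a set L of leaves: at a node with a child, the node itself
  -- is not in L, so the cone sum is the sum of the cone sums of the children;
  -- at a childless node only the node itself can contribute.
  internal-cone : ∀ σ {c} h L → All (Leaf T) L → c ∈ children σ →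
    coneSum h L σ ≡ sumOver (coneSum h L) (children σ)
  internal-cone σ {c} h L L-leaves c∈ = begin
    coneSum h L σ                                                     ≡⟨ cone-decomposition σ h L (All.map proj₁ L-leaves) ⟩
    sumOver (restrict (eqSeq σ) h) L +ℚ sumOver (coneSum h L) (children σ)
      ≡⟨ cong (_+ℚ sumOver (coneSum h L) (children σ)) (sumOver-zero L σ∉L) ⟩
    0ℚ +ℚ sumOver (coneSum h L) (children σ)                          ≡⟨ ℚₚ.+-identityˡ _ ⟩
    sumOver (coneSum h L) (children σ)                                ∎
    where
    open ≡-Reasoning
    σ∉L : ∀ τ → τ ∈ L → restrict (eqSeq σ) h τ ≡ 0ℚ
    σ∉L τ τ∈ = restrict-false (eqSeq σ) h λ σ≡τ →
      child⇒¬leaf σ c∈ (subst (Leaf T) (sym (eqSeq-sound σ τ σ≡τ)) (All.lookup L-leaves τ∈))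

  childless-cone : ∀ σ h L → All (_∈ T) L → children σ ≡ [] →
    coneSum h L σ ≡ sumOver (restrict (eqSeq σ) h) L
  childless-cone σ h L L⊆T none = trans (cone-decomposition σ h L L⊆T)
    (trans (cong (λ cs → sumOver (restrict (eqSeq σ) h) L +ℚ sumOver (coneSum h L) cs) none) (ℚₚ.+-identityʳ _))

  children-sum-≤ : ∀ σ {c} (f : Seq → ℚ) d → c ∈ children σ → (∀ c′ → c′ ∈ children σ → f c′ ≤ d *ℚ mT T c′) →
    sumOver f (children σ) ≤ d *ℚ mT T σ
  children-sum-≤ σ f d c∈ bound = begin
    sumOver f (children σ)                                       ≤⟨ sumOver-bound (children σ) each ⟩
    toℚ (childCount T σ) *ℚ (d *ℚ (mT T σ *ℚ inv (childCount T σ))) ≡⟨ share-out σ d c∈ ⟩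
    d *ℚ mT T σ                                                  ∎
    where
    open ℚₚ.≤-Reasoning
    each : ∀ c′ → c′ ∈ children σ → f c′ ≤ d *ℚ (mT T σ *ℚ inv (childCount T σ))
    each c′ c′∈ = ℚₚ.≤-trans (bound c′ c′∈) (ℚₚ.≤-reflexive (cong (d *ℚ_) (child-mass σ c′∈)))

  children-sum-< : ∀ σ {c} (f : Seq → ℚ) d → c ∈ children σ → (∀ c′ → c′ ∈ children σ → f c′ < d *ℚ mT T c′) →
    sumOver f (children σ) < d *ℚ mT T σ
  children-sum-< σ f d c∈ bound = begin-strict
    sumOver f (children σ)                                       <⟨ sumOver-bound-< (children σ) each (nonempty σ c∈) ⟩
    toℚ (childCount T σ) *ℚ (d *ℚ (mT T σ *ℚ inv (childCount T σ))) ≡⟨ share-out σ d c∈ ⟩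
    d *ℚ mT T σ                                                  ∎
    where
    open ℚₚ.≤-Reasoning
    each : ∀ c′ → c′ ∈ children σ → f c′ < d *ℚ (mT T σ *ℚ inv (childCount T σ))
    each c′ c′∈ = ℚₚ.<-≤-trans (bound c′ c′∈) (ℚₚ.≤-reflexive (cong (d *ℚ_) (child-mass σ c′∈)))

  leaves-in-cone : ∀ L → Unique L → All (Leaf T) L → ∀ σ → σ ∈ T → coneSum (mT T) L σ ≤ mT T σ
  leaves-in-cone L L-unique L-leaves = tree-ind (λ σ → σ ∈ T → coneSum (mT T) L σ ≤ mT T σ) step
    where
    step : ∀ σ → (∀ c → c ∈ children σ → c ∈ T → coneSum (mT T) L c ≤ mT T c) →
      σ ∈ T → coneSum (mT T) L σ ≤ mT T σ
    step σ ih σ∈T with child-view σ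
    ... | childless none = ℚₚ.≤-trans (ℚₚ.≤-reflexive (childless-cone σ (mT T) L (All.map proj₁ L-leaves) none))
      (sumOver-≤-single (eqSeq σ) (mT T) L L-unique (mass-nonNeg T σ) (λ τ σ≡τ → sym (eqSeq-sound σ τ σ≡τ)))
    ... | has-child c∈ = begin
      coneSum (mT T) L σ                       ≡⟨ internal-cone σ (mT T) L L-leaves c∈ ⟩
      sumOver (coneSum (mT T) L) (children σ)  ≤⟨ children-sum-≤ σ (coneSum (mT T) L) 1ℚ c∈ below ⟩
      1ℚ *ℚ mT T σ                             ≡⟨ ℚₚ.*-identityˡ (mT T σ) ⟩
      mT T σ                                   ∎
      where
      open ℚₚ.≤-Reasoning
      below : ∀ c′ → c′ ∈ children σ → coneSum (mT T) L c′ ≤ 1ℚ *ℚ mT T c′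
      below c′ c′∈ = ℚₚ.≤-trans (ih c′ c′∈ (proj₁ (child-shape σ c′∈)))
        (ℚₚ.≤-reflexive (sym (ℚₚ.*-identityˡ (mT T c′))))

module Pruning (n m a b : ℕ) {T : FinSet} (T∈𝒯 : InTT (n + m) a b T)
               {P : FinSet} (P-unique : Unique P) (P-leaves : All (Leaf T) P) where
  open InTT T∈𝒯
  open IsFiniteTree isTree
  open FiniteTree isTree

  μ : Seq → ℚ
  μ = mT T

  weight : Seq → ℚ
  weight = coneSum μ P

  δ : ℕ → ℚ
  δ ℓ = pow½ (m * suc ℓ)

  δ-antitone : ∀ {ℓ ℓ′} → ℓ ℕ.≤ ℓ′ → δ ℓ′ ≤ δ ℓ
  δ-antitone ℓ≤ℓ′ = pow½-antitone (ℕₚ.*-monoʳ-≤ m (ℕ.s≤s ℓ≤ℓ′))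

  heavy? : ∀ σ → Dec (δ (length σ) *ℚ μ σ ≤ weight σ)
  heavy? σ = δ (length σ) *ℚ μ σ ℚₚ.≤? weight σ

  heavy : Seq → Bool
  heavy σ = isYes (heavy? σ)

  light : ∀ σ → ¬ IsTrue (heavy σ) → weight σ < δ (length σ) *ℚ μ σ
  light σ not-heavy = ℚₚ.≰⇒> (not-heavy ∘ fromWitness)

  -- keptFrom pre ρ: every initial segment of pre ++ ρ extending pre is heavy.
  keptFrom : Seq → Seq → Bool
  keptFrom pre [] = heavy pre
  keptFrom pre (x ∷ ρ) = heavy pre ∧ keptFrom (pre ∷ʳ x) ρ

  kept : Seq → Bool
  kept = keptFrom []

  kept⇒heavy : ∀ σ → IsTrue (kept σ) → IsTrue (heavy σ)
  kept⇒heavy = go []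
    where
    go : ∀ pre σ → IsTrue (keptFrom pre σ) → IsTrue (heavy (pre ++ σ))
    go pre [] k = subst (IsTrue ∘ heavy) (sym (Listₚ.++-identityʳ pre)) k
    go pre (x ∷ σ) k = subst (IsTrue ∘ heavy) (Listₚ.++-assoc pre [ x ] σ)
      (go (pre ∷ʳ x) σ (proj₂ (Equivalence.to (T-∧ {heavy pre}) k)))

  kept-take : ∀ σ i → IsTrue (kept σ) → IsTrue (kept (take i σ))
  kept-take = go []
    where
    go : ∀ pre σ i → IsTrue (keptFrom pre σ) → IsTrue (keptFrom pre (take i σ))
    go pre [] zero k = k
    go pre [] (suc i) k = k
    go pre (x ∷ σ) zero k = proj₁ (Equivalence.to (T-∧ {heavy pre}) k)
    go pre (x ∷ σ) (suc i) k with Equivalence.to (T-∧ {heavy pre}) k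
    ... | h , k′ = Equivalence.from (T-∧ {heavy pre}) (h , go (pre ∷ʳ x) σ i k′)

  kept-child : ∀ σ {c} → c ∈ children σ → IsTrue (kept σ) → IsTrue (heavy c) → IsTrue (kept c)
  kept-child σ c∈ k h with child-shape σ c∈
  ... | _ , x , refl = go [] σ k h
    where
    go : ∀ pre σ → IsTrue (keptFrom pre σ) → IsTrue (heavy ((pre ++ σ) ∷ʳ x)) → IsTrue (keptFrom pre (σ ∷ʳ x))
    go pre [] k h = Equivalence.from (T-∧ {heavy pre}) (k , subst (IsTrue ∘ heavy) (cong (_∷ʳ x) (Listₚ.++-identityʳ pre)) h)
    go pre (y ∷ σ) k h with Equivalence.to (T-∧ {heavy pre}) k
    ... | h₀ , k′ = Equivalence.from (T-∧ {heavy pre})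
      (h₀ , go (pre ∷ʳ y) σ k′ (subst (IsTrue ∘ heavy ∘ (_∷ʳ x)) (sym (Listₚ.++-assoc pre [ y ] σ)) h))

  discarded-child-light : ∀ σ {c} → c ∈ children σ → IsTrue (kept σ) → ¬ IsTrue (kept c) →
    weight c < δ (suc (length σ)) *ℚ μ c
  discarded-child-light σ {c} c∈ kσ not-kept = subst (λ ℓ → weight c < δ ℓ *ℚ μ c) (child-length σ c∈)
    (light c (not-kept ∘ kept-child σ c∈ kσ))

  weight≤mass : ∀ σ → σ ∈ T → weight σ ≤ μ σ
  weight≤mass = leaves-in-cone P P-unique P-leaves

  discarded : Seq → ℚ
  discarded = coneSum (restrict (not ∘ kept) μ) P

  discarded≤weight : ∀ σ → discarded σ ≤ weight σ
  discarded≤weight σ = sumOver-mono P λ τ _ → restrict-≤ τ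
    where
    restrict-≤ : ∀ τ → restrict (σ ⊑ᵇ_) (restrict (not ∘ kept) μ) τ ≤ restrict (σ ⊑ᵇ_) μ τ
    restrict-≤ τ with σ ⊑ᵇ τ | kept τ
    ... | true | false = ℚₚ.≤-refl
    ... | true | true = mass-nonNeg T τ
    ... | false | _ = ℚₚ.≤-refl

  discarded-bound : ∀ σ → σ ∈ T → IsTrue (kept σ) → discarded σ < δ (suc (length σ)) *ℚ μ σ
  discarded-bound = tree-ind (λ σ → σ ∈ T → IsTrue (kept σ) → discarded σ < δ (suc (length σ)) *ℚ μ σ) step
    where
    step : ∀ σ → (∀ c → c ∈ children σ → c ∈ T → IsTrue (kept c) → discarded c < δ (suc (length c)) *ℚ μ c) →
      σ ∈ T → IsTrue (kept σ) → discarded σ < δ (suc (length σ)) *ℚ μ σ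
    step σ ih σ∈T kσ with child-view σ
    ... | childless none = ℚₚ.≤-<-trans (ℚₚ.≤-reflexive (trans
          (childless-cone σ (restrict (not ∘ kept) μ) P (All.map proj₁ P-leaves) none)
          (sumOver-zero P (λ τ _ → not-discarded τ))))
        (*-pos (pow½-pos (m * suc (suc (length σ)))) (mass-pos σ∈T))
      where
      not-discarded : ∀ τ → restrict (eqSeq σ) (restrict (not ∘ kept) μ) τ ≡ 0ℚ
      not-discarded τ with IsTrue? (eqSeq σ τ)
      ... | no σ≢τ = restrict-false (eqSeq σ) (restrict (not ∘ kept) μ) σ≢τ
      ... | yes σ≡τ with eqSeq-sound σ τ σ≡τ
      ...   | refl = trans (restrict-true (eqSeq σ) (restrict (not ∘ kept) μ) σ≡τ) (restrict-false (not ∘ kept) μ {σ} (not-both kσ))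
    ... | has-child c∈ = begin-strict
      discarded σ                                      ≡⟨ internal-cone σ (restrict (not ∘ kept) μ) P P-leaves c∈ ⟩
      sumOver discarded (children σ)                   <⟨ children-sum-< σ discarded (δ (suc (length σ))) c∈ per-child ⟩
      δ (suc (length σ)) *ℚ μ σ                        ∎
      where
      open ℚₚ.≤-Reasoning
      per-child : ∀ c → c ∈ children σ → discarded c < δ (suc (length σ)) *ℚ μ c
      per-child c c∈ with IsTrue? (kept c)
      ... | yes kc = ℚₚ.<-≤-trans (ih c c∈ (proj₁ (child-shape σ c∈)) kc)
          (ℚₚ.*-monoʳ-≤-nonNeg (μ c) {{ℚ.nonNegative (mass-nonNeg T c)}}
            (δ-antitone (ℕₚ.≤-trans (ℕₚ.n≤1+n (suc (length σ))) (ℕₚ.≤-reflexive (cong suc (sym (child-length σ c∈)))))))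
      ... | no ¬kc = ℚₚ.≤-<-trans (discarded≤weight c) (discarded-child-light σ c∈ kσ ¬kc)

  keptChildren discardedChildren : Seq → FinSet
  keptChildren σ = filterᵇ kept (children σ)
  discardedChildren σ = filterᵇ (not ∘ kept) (children σ)

  share : Seq → ℚ
  share σ = μ σ *ℚ inv (childCount T σ)

  kept-children-weight : ∀ σ → sumOver weight (keptChildren σ) ≤ toℚ (length (keptChildren σ)) *ℚ share σ
  kept-children-weight σ = sumOver-bound (keptChildren σ) λ c c∈Kept →
    let c∈ = proj₁ (∈-filterᵇ⁻ kept {xs = children σ} c∈Kept) in
    ℚₚ.≤-trans (weight≤mass c (proj₁ (child-shape σ c∈))) (ℚₚ.≤-reflexive (child-mass σ c∈))

  discarded-children-light : ∀ σ → IsTrue (kept σ) → ∀ c → c ∈ discardedChildren σ →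
    weight c < δ (suc (length σ)) *ℚ share σ
  discarded-children-light σ kσ c c∈Discarded with ∈-filterᵇ⁻ (not ∘ kept) {xs = children σ} c∈Discarded
  ... | c∈ , not-kept = subst (λ x → weight c < δ (suc (length σ)) *ℚ x) (child-mass σ c∈)
    (discarded-child-light σ c∈ kσ (λ kc → not-both kc not-kept))

  -- With K children, A kept and D discarded,
  -- heaviness of σ gives
  --   δ(|σ|)·K·share ≤ w(σ) = Σ_kept w + Σ_discarded w ≤ (A + D·δ(|σ|+1))·share,
  -- strictly if D > 0; cancelling the share, enough-kept does the arithmetic.
  kept-children : ∀ σ → σ ∈ T → IsTrue (kept σ) → ε (n + m) a b (length σ) ℕ.≤ childCount T σ →
    ε n a b (length σ) ℕ.≤ length (keptChildren σ)
  kept-children σ σ∈T kσ εK with child-view σ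
  ... | childless none = ⊥-elim (ℕₚ.<-irrefl refl (ℕₚ.<-≤-trans (ε-pos (n + m) a b (length σ))
        (ℕₚ.≤-trans εK (ℕₚ.≤-reflexive (cong length none)))))
  ... | has-child c∈ = enough-kept n m a b (length σ) (length-split kept (children σ)) balance balance-strict εK
    where
    K : ℕ
    K = childCount T σ
    A′ D′ δ₀ δ₁ : ℚ
    A′ = toℚ (length (keptChildren σ))
    D′ = toℚ (length (discardedChildren σ))
    δ₀ = δ (length σ)
    δ₁ = δ (suc (length σ))

    share-pos : 0ℚ < share σ
    share-pos with K | nonempty σ c∈
    ... | suc k | _ = *-pos (mass-pos σ∈T) (inv-pos k)

    heavy-bound : (δ₀ *ℚ toℚ K) *ℚ share σ ≤ sumOver weight (keptChildren σ) +ℚ sumOver weight (discardedChildren σ)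
    heavy-bound = begin
      δ₀ *ℚ toℚ K *ℚ share σ        ≡⟨ ℚₚ.*-assoc δ₀ (toℚ K) (share σ) ⟩
      δ₀ *ℚ (toℚ K *ℚ share σ)      ≡⟨ cong (δ₀ *ℚ_) (children-mass K (μ σ) (nonempty σ c∈)) ⟩
      δ₀ *ℚ μ σ                     ≤⟨ toWitness (kept⇒heavy σ kσ) ⟩
      weight σ                      ≡⟨ internal-cone σ μ P P-leaves c∈ ⟩
      sumOver weight (children σ)   ≡⟨ sumOver-split kept weight (children σ) ⟩
      sumOver weight (keptChildren σ) +ℚ sumOver weight (discardedChildren σ) ∎
      where open ℚₚ.≤-Reasoning

    regroup : A′ *ℚ share σ +ℚ D′ *ℚ (δ₁ *ℚ share σ) ≡ (A′ +ℚ D′ *ℚ δ₁) *ℚ share σ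
    regroup = solve 4 (λ A D d s → A :* s :+ D :* (d :* s) := (A :+ D :* d) :* s) refl A′ D′ δ₁ (share σ)
      where open +-*-Solver

    balance : δ₀ *ℚ toℚ K ≤ A′ +ℚ D′ *ℚ δ₁
    balance = ℚₚ.*-cancelʳ-≤-pos (share σ) {{ℚ.positive share-pos}} (ℚₚ.≤-trans heavy-bound
      (ℚₚ.≤-trans (ℚₚ.+-mono-≤ (kept-children-weight σ)
        (sumOver-bound (discardedChildren σ) (λ c c∈ → ℚₚ.<⇒≤ (discarded-children-light σ kσ c c∈))))
        (ℚₚ.≤-reflexive regroup)))

    balance-strict : 0 ℕ.< length (discardedChildren σ) → δ₀ *ℚ toℚ K < A′ +ℚ D′ *ℚ δ₁
    balance-strict D>0 = ℚₚ.*-cancelʳ-<-nonNeg (share σ) {{ℚ.nonNegative (ℚₚ.<⇒≤ share-pos)}} (ℚₚ.≤-<-trans heavy-bound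
      (ℚₚ.<-≤-trans (ℚₚ.+-mono-≤-< (kept-children-weight σ)
        (sumOver-bound-< (discardedChildren σ) (discarded-children-light σ kσ) D>0))
        (ℚₚ.≤-reflexive regroup)))

  S : FinSet
  S = filterᵇ kept T

  S-member : ∀ {σ} → σ ∈ S → σ ∈ T × IsTrue (kept σ)
  S-member = ∈-filterᵇ⁻ kept

  S-tree : IsFiniteTree S
  S-tree = record
    { unique = unique-filterᵇ kept unique
    ; strict = All.filter⁺ (IsTrue? ∘ kept) strict
    ; prefixed = λ σ i σ∈S → let (σ∈T , kσ) = S-member σ∈S in
        ∈-filterᵇ⁺ kept (prefixed σ i σ∈T) (kept-take σ i kσ)
    }
    where import Data.List.Relation.Unary.All.Properties as All

  leaf-T⇒leaf-S : ∀ {σ} → σ ∈ S → Leaf T σ → Leaf S σ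
  leaf-T⇒leaf-S σ∈S (_ , no-ext) = σ∈S , λ τ τ∈S → no-ext τ (proj₁ (S-member τ∈S))

  S-childCount : ∀ σ → childCount S σ ≡ length (keptChildren σ)
  S-childCount σ = cong length (filterᵇ-comm (isChild σ) kept T)

  -- S ∈ 𝒯(n,a,b): a non-leaf of S is a non-leaf of T, so has at least
  -- ε_{n+m}(|σ|) children in T, hence at least ε_n(|σ|) kept ones.
  S∈𝒯 : InTT n a b S
  S∈𝒯 = record
    { isTree = S-tree
    ; branching = λ σ σ∈S not-leaf → let (σ∈T , kσ) = S-member σ∈S in
        subst (ε n a b (length σ) ℕ.≤_) (sym (S-childCount σ))
          (kept-children σ σ∈T kσ (branching σ σ∈T (not-leaf ∘ leaf-T⇒leaf-S σ∈S)))
    }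

  -- A kept node with a child in T has at least ε_n(|σ|) > 0 kept children,
  -- so it is not a leaf of S.
  kept-extension : ∀ σ {c} → σ ∈ T → IsTrue (kept σ) → c ∈ children σ → Σ Seq λ c′ → c′ ∈ S × σ ≺ c′
  kept-extension σ σ∈T kσ c∈ with member-of-nonempty (keptChildren σ)
    (ℕₚ.<-≤-trans (ε-pos n a b (length σ)) (kept-children σ σ∈T kσ (branching σ σ∈T (child⇒¬leaf σ c∈))))
  ... | c′ , c′∈Kept with ∈-filterᵇ⁻ kept {xs = children σ} c′∈Kept
  ...   | c′∈ , kc′ with child-shape σ c′∈
  ...     | c′∈T , x , refl = σ ∷ʳ x , ∈-filterᵇ⁺ kept c′∈T kc′ , (x , [] , refl)

  -- A kept node without children is heavy, so it carries mass of P; having no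
  -- proper extensions, it must itself be in P.
  kept-childless∈P : ∀ σ → σ ∈ T → IsTrue (kept σ) → children σ ≡ [] → σ ∈ P
  kept-childless∈P σ σ∈T kσ none with sumOver-pos (eqSeq σ) μ P (begin-strict
    0ℚ                                  <⟨ *-pos (pow½-pos (m * suc (length σ))) (mass-pos σ∈T) ⟩
    δ (length σ) *ℚ μ σ                 ≤⟨ toWitness (kept⇒heavy σ kσ) ⟩
    weight σ                            ≡⟨ childless-cone σ μ P (All.map proj₁ P-leaves) none ⟩
    sumOver (restrict (eqSeq σ) μ) P    ∎)
    where open ℚₚ.≤-Reasoning
  ... | τ , τ∈P , σ≡τ = subst (_∈ P) (sym (eqSeq-sound σ τ σ≡τ)) τ∈P

  S-leaves⊆P : ∀ σ → Leaf S σ → σ ∈ P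
  S-leaves⊆P σ (σ∈S , no-ext) with S-member σ∈S | child-view σ
  ... | σ∈T , kσ | childless none = kept-childless∈P σ σ∈T kσ none
  ... | σ∈T , kσ | has-child c∈ with kept-extension σ σ∈T kσ c∈
  ...   | c′ , c′∈S , σ≺c′ = ⊥-elim (no-ext c′ c′∈S σ≺c′)

  not-leaf⇒discarded : ∀ {σ} → σ ∈ P → ¬ Leaf S σ → IsTrue (not (kept σ))
  not-leaf⇒discarded {σ} σ∈P not-leaf = not-either λ kσ →
    not-leaf (leaf-T⇒leaf-S (∈-filterᵇ⁺ kept (proj₁ (All.lookup P-leaves σ∈P)) kσ) (All.lookup P-leaves σ∈P))

  discarded⇒not-leaf : ∀ {σ} → IsTrue (not (kept σ)) → ¬ Leaf S σ
  discarded⇒not-leaf not-kept (σ∈S , _) = not-both (proj₂ (S-member σ∈S)) not-kept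

  -- The mass of P outside the leaves of S is the mass discarded below the
  -- root, which is below δ(1) = 2^{-2m} ≤ 2^{-m}.  The root is kept because
  -- P has mass at least 2^{-m}.
  loss : NonEmpty T → pow½ m ≤ mTset T P →
    ∀ Q → Unique Q → (∀ σ → σ ∈ Q ⇔ (σ ∈ P × ¬ Leaf S σ)) → mTset T Q < pow½ m
  loss (σ₀ , σ₀∈T) P-heavy Q Q-unique Q-members = begin-strict
    mTset T Q                           ≡⟨ mTset≡sumOver T Q ⟩
    sumOver μ Q                         ≡⟨ sumOver-sameSet μ Q-unique (unique-filterᵇ (not ∘ kept) P-unique) same-members ⟩
    sumOver μ (filterᵇ (not ∘ kept) P)  ≡⟨ sumOver-restrict (not ∘ kept) μ P ⟨
    discarded []                        <⟨ discarded-bound [] root∈T root-kept ⟩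
    pow½ (m * 2) *ℚ 1ℚ                  ≡⟨ ℚₚ.*-identityʳ (pow½ (m * 2)) ⟩
    pow½ (m * 2)                        ≤⟨ pow½-antitone (ℕₚ.m≤m*n m 2) ⟩
    pow½ m                              ∎
    where
    open ℚₚ.≤-Reasoning
    root∈T : [] ∈ T
    root∈T = prefixed σ₀ 0 σ₀∈T
    root-kept : IsTrue (kept [])
    root-kept = fromWitness (begin
      pow½ (m * 1) *ℚ 1ℚ  ≡⟨ ℚₚ.*-identityʳ (pow½ (m * 1)) ⟩
      pow½ (m * 1)        ≡⟨ cong pow½ (ℕₚ.*-identityʳ m) ⟩
      pow½ m              ≤⟨ P-heavy ⟩
      mTset T P           ≡⟨ mTset≡sumOver T P ⟩
      weight []           ∎)
    same-members : ∀ {σ} → σ ∈ Q ⇔ σ ∈ filterᵇ (not ∘ kept) P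
    same-members {σ} = mk⇔
      (λ σ∈Q → let (σ∈P , not-leaf) = Equivalence.to (Q-members σ) σ∈Q in
        ∈-filterᵇ⁺ (not ∘ kept) σ∈P (not-leaf⇒discarded σ∈P not-leaf))
      (λ σ∈D → let (σ∈P , not-kept) = ∈-filterᵇ⁻ (not ∘ kept) σ∈D in
        Equivalence.from (Q-members σ) (σ∈P , discarded⇒not-leaf not-kept))

lemma4p1 : (n m a b : ℕ) (T : FinSet) → InTT (n + m) a b T → NonEmpty T →
    (P : FinSet) → Unique P → All (Leaf T) P → pow½ m ≤ mTset T P →
    Σ FinSet λ S → InTT n a b S × (∀ σ → Leaf S σ → σ ∈ P) ×
      (∀ (Q : FinSet) → Unique Q → (∀ σ → σ ∈ Q ⇔ (σ ∈ P × (Leaf S σ → ⊥))) →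
        mTset T Q < pow½ m)
lemma4p1 n m a b T T∈𝒯 T-nonempty P P-unique P-leaves P-heavy =
  S , S∈𝒯 , S-leaves⊆P , loss T-nonempty P-heavy
  where open Pruning n m a b T∈𝒯 P-unique P-leaves
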